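{- For all $f(x)\in V$, \[ \mathcal{F}(f(x))=b_0\cdot\mathcal{L}(x^{ -1}f(x)). \]
   Context: Let $\{b_n\}_{n\ge0},\{a_n\}_{n\ge0}$ be sequences of complex numbers and define $P_{ -1}(x)=0$, $P_0(x)=1$, $P_{n+1}(x)=(x-b_n)P_n(x)-a_nxP_{n-1}(x)$ for $n\ge0$. Assume $P_n(0)\neq0$ and $a_n\neq0$ for all $n\ge1$ (so in particular $b_n\neq 0$ for all $n$, since $P_n(0)=(-1)^nb_0\cdots b_{n-1}$). Let $V$ be the vector space of Laurent polynomials in $x$. Let $\mathcal{F}$ be the unique linear functional on $V$ with $\mathcal{F}(1)=1$ and $\mathcal{F}(x^{ -n}P_m(x))=0$ for $0\le n<m$, and let $\mathcal{L}$ be the unique linear functional on $V$ with $\mathcal{L}(1)=1$ and $\mathcal{L}(x^{ -n}P_m(x))=0$ for $0<n\le m$. -}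

module Defs where

open import Level using (Level; _⊔_) renaming (suc to lsuc)
open import Algebra.Bundles using (CommutativeRing)
open import Data.Nat using (ℕ; zero; suc)
import Data.Integer as ℤ
open ℤ using (ℤ; +_)
open import Data.List using (List; []; _∷_)
open import Data.Product using (Σ; _×_; _,_)
open import Relation.Nullary using (¬_)

record Field (c ℓ : Level) : Set (lsuc (c ⊔ ℓ)) where
  field
    commutativeRing : CommutativeRing c ℓ
  open CommutativeRing commutativeRing public
  field
    1#≉0#   : ¬ (1# ≈ 0#)
    inverse : ∀ x → ¬ (x ≈ 0#) → Σ Carrier (λ y → x * y ≈ 1#)

module FieldDefs {c ℓ : Level} (K : Field c ℓ) where
  open Field K

  -- Polynomials in x over K as coefficient lists, constant term first:
  -- c₀ ∷ c₁ ∷ … ∷ cₖ ∷ []  represents  c₀ + c₁ x + … + cₖ xᵏ.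
  Poly : Set c
  Poly = List Carrier

  infixl 6 _⊕_
  _⊕_ : Poly → Poly → Poly
  []       ⊕ q        = q
  (p ∷ ps) ⊕ []       = p ∷ ps
  (p ∷ ps) ⊕ (q ∷ qs) = (p + q) ∷ (ps ⊕ qs)

  _·_ : Carrier → Poly → Poly
  k · []       = []
  k · (p ∷ ps) = (k * p) ∷ (k · ps)

  X* : Poly → Poly
  X* p = 0# ∷ p

  at0 : Poly → Carrier
  at0 []      = 0#
  at0 (p ∷ _) = p

  -- The sequence P_n defined by P_{-1} = 0, P_0 = 1,
  -- P_{n+1}(x) = (x - b_n) P_n(x) - a_n x P_{n-1}(x).
  -- PP b a n = (P_n , P_{n+1}).
  PP : (b a : ℕ → Carrier) → ℕ → Poly × Poly
  PP b a zero    = (1# ∷ []) , (X* (1# ∷ []) ⊕ ((- b 0) · (1# ∷ [])))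
  PP b a (suc n) with PP b a n
  ... | (p , q) = q , (X* q ⊕ ((- b (suc n)) · q) ⊕ ((- a (suc n)) · X* p))

  P : (b a : ℕ → Carrier) → ℕ → Poly
  P b a n with PP b a n
  ... | (p , _) = p

  -- Laurent polynomials: a pair (n , p) represents x^{-n} p(x).
  -- Every Laurent polynomial has this form.
  Laurent : Set c
  Laurent = ℕ × Poly

  x⁻¹* : Laurent → Laurent
  x⁻¹* (n , p) = (suc n , p)

  -- A linear functional on V is determined by its (arbitrary) values on the
  -- monomial basis {x^k : k ∈ ℤ}; given those moments, its value on a
  -- Laurent polynomial is computed by linearity.
  Functional : Set c
  Functional = ℤ → Carrier

  apply-from : Functional → ℤ → Poly → Carrier
  apply-from μ k []       = 0#
  apply-from μ k (p ∷ ps) = p * μ k + apply-from μ (k ℤ.+ + 1) ps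

  apply : Functional → Laurent → Carrier
  apply μ (n , p) = apply-from μ (ℤ.- (+ n)) p

-- The functional D(f) = 𝓕(f) − b₀ 𝓛(x⁻¹f) vanishes on 1, because
-- 𝓛(x⁻¹P₁) = 0 gives b₀ 𝓛(x⁻¹) = 𝓛(1) = 1 = 𝓕(1), and it annihilates x⁻ⁿP_m for
-- n < m, by the orthogonality relations of 𝓕 and 𝓛. Such a functional is zero:
-- as P_m is monic of degree m, the relations D(P_m) = 0 kill the moments D(xᵐ)
-- one degree at a time; then, as P_{n+2}(0) ≠ 0, the relation
-- D(x⁻ⁿ⁻¹P_{n+2}) = 0 kills D(x⁻ⁿ⁻¹) once all higher moments are known to vanish.

module Submission where

open import Defs
open import Level using (Level)
open import Data.Nat using (ℕ; zero; suc; _<_; _≤_; z≤n; s≤s)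
open import Data.Integer using (+_)
open import Data.List using ([]; _∷_)
open import Data.Product using (_,_)
open import Relation.Nullary using (¬_)

import Data.Nat.Properties as ℕₚ
open import Data.Nat.Induction using (<-rec)
import Data.Integer as ℤ
import Data.Integer.Properties as ℤₚ
open ℤ using (ℤ; -[1+_]; -1ℤ)
open import Data.List using (_++_; length)
open import Data.List.Properties using (length-++)
open import Data.Product using (Σ-syntax; _×_; proj₁; proj₂)
open import Data.Empty using (⊥-elim)
import Relation.Binary.PropositionalEquality as ≡
open ≡ using (_≡_)
open import Algebra.Properties.CommutativeSemigroup ℤₚ.+-commutativeSemigroup
  using () renaming (xy∙z≈xz∙y to i+j+k≡i+k+j)

-[1+m]+[1+n]≡-m+n : ∀ m n → -[1+ m ] ℤ.+ + suc n ≡ ℤ.- (+ m) ℤ.+ + n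
-[1+m]+[1+n]≡-m+n zero    n = ≡.refl
-[1+m]+[1+n]≡-m+n (suc m) n = ℤₚ.[1+m]⊖[1+n]≡m⊖n n (suc m)

-m+-1≡-[1+m] : ∀ m → ℤ.- (+ m) ℤ.+ -1ℤ ≡ -[1+ m ]
-m+-1≡-[1+m] zero    = ≡.refl
-m+-1≡-[1+m] (suc m) = ≡.cong (λ k → -[1+ suc k ]) (ℕₚ.+-identityʳ m)

module _ {c ℓ : Level} (K : Field c ℓ) where
  open Field K
  open FieldDefs K
  open import Relation.Binary.Reasoning.Setoid setoid
  open import Algebra.Properties.Group +-group using (x∙y⁻¹≈ε⇒x≈y)
  open import Algebra.Properties.CommutativeSemigroup +-commutativeSemigroup using (interchange)
  open import Algebra.Properties.CommutativeSemigroup *-commutativeSemigroup using (x∙yz≈y∙xz)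
  open import Algebra.Properties.Ring ring using (-‿distribˡ-*)

  x≉0∧x*y≈0⇒y≈0 : ∀ {x y} → ¬ (x ≈ 0#) → x * y ≈ 0# → y ≈ 0#
  x≉0∧x*y≈0⇒y≈0 {x} {y} x≉0 x*y≈0 with inverse x x≉0
  ... | x⁻¹ , x*x⁻¹≈1 = begin
    y               ≈⟨ *-identityˡ y ⟨
    1# * y          ≈⟨ *-congʳ x*x⁻¹≈1 ⟨
    (x * x⁻¹) * y   ≈⟨ *-congʳ (*-comm x x⁻¹) ⟩
    (x⁻¹ * x) * y   ≈⟨ *-assoc x⁻¹ x y ⟩
    x⁻¹ * (x * y)   ≈⟨ *-congˡ x*y≈0 ⟩
    x⁻¹ * 0#        ≈⟨ zeroʳ x⁻¹ ⟩
    0#              ∎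

  Monic : ℕ → Poly → Set c
  Monic n p = Σ[ cs ∈ Poly ] length cs ≡ n × p ≡ cs ++ 1# ∷ []

  length-monic : ∀ {n p} → Monic n p → length p ≡ suc n
  length-monic (cs , ≡.refl , ≡.refl) =
    ≡.trans (length-++ cs) (ℕₚ.+-comm (length cs) 1)

  length-· : ∀ k p → length (k · p) ≡ length p
  length-· k []       = ≡.refl
  length-· k (p ∷ ps) = ≡.cong suc (length-· k ps)

  monic-X* : ∀ {n p} → Monic n p → Monic (suc n) (X* p)
  monic-X* (cs , ≡.refl , ≡.refl) = 0# ∷ cs , ≡.refl , ≡.refl

  monic-⊕ : ∀ {n p q} → Monic n p → length q ≤ n → Monic n (p ⊕ q)
  monic-⊕ {q = []} ([] , ≡.refl , ≡.refl) _ = [] , ≡.refl , ≡.refl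
  monic-⊕ {q = []} (c ∷ cs , ≡.refl , ≡.refl) _ = c ∷ cs , ≡.refl , ≡.refl
  monic-⊕ {q = d ∷ q} (c ∷ cs , ≡.refl , ≡.refl) (s≤s q≤cs)
    with monic-⊕ {q = q} (cs , ≡.refl , ≡.refl) q≤cs
  ... | ds , ds≡cs , p⊕q≡ds = c + d ∷ ds , ≡.cong suc ds≡cs , ≡.cong (c + d ∷_) p⊕q≡ds

  module _ (b a : ℕ → Carrier) where

    PP-monic : ∀ n → Monic n (proj₁ (PP b a n)) × Monic (suc n) (proj₂ (PP b a n))
    PP-monic zero = ([] , ≡.refl , ≡.refl) , (_ ∷ [] , ≡.refl , ≡.refl)
    PP-monic (suc n) with PP b a n | PP-monic n
    ... | p , q | monic-p , monic-q =
      monic-q , monic-⊕ {q = (- a (suc n)) · X* p}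
                  (monic-⊕ {q = (- b (suc n)) · q} (monic-X* monic-q) (ℕₚ.≤-reflexive length-bq))
                  (ℕₚ.≤-reflexive length-axp)
      where
      length-bq : length ((- b (suc n)) · q) ≡ suc (suc n)
      length-bq = ≡.trans (length-· _ q) (length-monic monic-q)
      length-axp : length ((- a (suc n)) · X* p) ≡ suc (suc n)
      length-axp = ≡.trans (length-· _ (X* p)) (≡.cong suc (length-monic monic-p))

    P-monic : ∀ n → Monic n (P b a n)
    P-monic n with PP b a n | PP-monic n
    ... | _ | monic-p , _ = monic-p

  apply-from-cong-index : ∀ μ {k j} → k ≡ j → ∀ p → apply-from μ k p ≈ apply-from μ j p
  apply-from-cong-index μ k≡j p = reflexive (≡.cong (λ i → apply-from μ i p) k≡j)

  apply-from-++ : ∀ μ k p q →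
    apply-from μ k (p ++ q) ≈ apply-from μ k p + apply-from μ (k ℤ.+ + length p) q
  apply-from-++ μ k [] q = begin
    apply-from μ k q                 ≈⟨ apply-from-cong-index μ (ℤₚ.+-identityʳ k) q ⟨
    apply-from μ (k ℤ.+ + 0) q       ≈⟨ +-identityˡ _ ⟨
    0# + apply-from μ (k ℤ.+ + 0) q  ∎
  apply-from-++ μ k (x ∷ p) q = begin
    x * μ k + apply-from μ (k ℤ.+ + 1) (p ++ q)
      ≈⟨ +-congˡ (apply-from-++ μ (k ℤ.+ + 1) p q) ⟩
    x * μ k + (apply-from μ (k ℤ.+ + 1) p + apply-from μ (k ℤ.+ + 1 ℤ.+ + length p) q)
      ≈⟨ +-assoc _ _ _ ⟨
    x * μ k + apply-from μ (k ℤ.+ + 1) p + apply-from μ (k ℤ.+ + 1 ℤ.+ + length p) q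
      ≈⟨ +-congˡ (apply-from-cong-index μ (ℤₚ.+-assoc k (+ 1) (+ length p)) q) ⟩
    x * μ k + apply-from μ (k ℤ.+ + 1) p + apply-from μ (k ℤ.+ + suc (length p)) q ∎

  apply-from-vanishing : ∀ μ k p → (∀ i → i < length p → μ (k ℤ.+ + i) ≈ 0#) →
    apply-from μ k p ≈ 0#
  apply-from-vanishing μ k []      _     = refl
  apply-from-vanishing μ k (x ∷ p) μ≈0 = begin
    x * μ k + apply-from μ (k ℤ.+ + 1) p  ≈⟨ +-cong (*-congˡ μk≈0) (apply-from-vanishing μ _ p μ≈0-shifted) ⟩
    x * 0# + 0#                           ≈⟨ +-identityʳ _ ⟩
    x * 0#                                ≈⟨ zeroʳ x ⟩
    0#                                    ∎
    where
    μk≈0 : μ k ≈ 0#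
    μk≈0 = trans (reflexive (≡.cong μ (≡.sym (ℤₚ.+-identityʳ k)))) (μ≈0 0 (s≤s z≤n))
    μ≈0-shifted : ∀ i → i < length p → μ (k ℤ.+ + 1 ℤ.+ + i) ≈ 0#
    μ≈0-shifted i i<p = trans (reflexive (≡.cong μ (ℤₚ.+-assoc k (+ 1) (+ i)))) (μ≈0 (suc i) (s≤s i<p))

  apply-from-+ : ∀ μ ν k p →
    apply-from (λ z → μ z + ν z) k p ≈ apply-from μ k p + apply-from ν k p
  apply-from-+ μ ν k []      = sym (+-identityʳ 0#)
  apply-from-+ μ ν k (x ∷ p) = begin
    x * (μ k + ν k) + apply-from (λ z → μ z + ν z) (k ℤ.+ + 1) p
      ≈⟨ +-cong (distribˡ x (μ k) (ν k)) (apply-from-+ μ ν (k ℤ.+ + 1) p) ⟩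
    (x * μ k + x * ν k) + (apply-from μ (k ℤ.+ + 1) p + apply-from ν (k ℤ.+ + 1) p)
      ≈⟨ interchange _ _ _ _ ⟩
    (x * μ k + apply-from μ (k ℤ.+ + 1) p) + (x * ν k + apply-from ν (k ℤ.+ + 1) p) ∎

  apply-from-* : ∀ α μ k p → apply-from (λ z → α * μ z) k p ≈ α * apply-from μ k p
  apply-from-* α μ k []      = sym (zeroʳ α)
  apply-from-* α μ k (x ∷ p) = begin
    x * (α * μ k) + apply-from (λ z → α * μ z) (k ℤ.+ + 1) p
      ≈⟨ +-cong (x∙yz≈y∙xz x α (μ k)) (apply-from-* α μ (k ℤ.+ + 1) p) ⟩
    α * (x * μ k) + α * apply-from μ (k ℤ.+ + 1) p
      ≈⟨ distribˡ α _ _ ⟨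
    α * (x * μ k + apply-from μ (k ℤ.+ + 1) p) ∎

  apply-from-shift : ∀ μ j k p → apply-from (λ z → μ (z ℤ.+ j)) k p ≡ apply-from μ (k ℤ.+ j) p
  apply-from-shift μ j k []      = ≡.refl
  apply-from-shift μ j k (x ∷ p) = ≡.cong (_+_ (x * μ (k ℤ.+ j))) (≡.trans
    (apply-from-shift μ j (k ℤ.+ + 1) p)
    (≡.cong (λ i → apply-from μ i p) (i+j+k≡i+k+j k (+ 1) j)))

  apply-x⁻¹ : ∀ μ f → apply (λ z → μ (z ℤ.+ -1ℤ)) f ≡ apply μ (x⁻¹* f)
  apply-x⁻¹ μ (n , p) = ≡.trans (apply-from-shift μ -1ℤ (ℤ.- (+ n)) p)
                                 (≡.cong (λ k → apply-from μ k p) (-m+-1≡-[1+m] n))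

  module _ (Q : ℕ → Poly) (Q-monic : ∀ n → Monic n (Q n))
           (Q-at0≉0 : ∀ n → ¬ (at0 (Q (suc n)) ≈ 0#))
           (D : Functional) (D₀≈0 : D (+ 0) ≈ 0#)
           (D⊥Q : ∀ n m → n < m → apply D (n , Q m) ≈ 0#) where

    vanishes-on-ℕ : ∀ m → D (+ m) ≈ 0#
    vanishes-on-ℕ = <-rec (λ m → D (+ m) ≈ 0#) step
      where
      step : ∀ m → (∀ {i} → i < m → D (+ i) ≈ 0#) → D (+ m) ≈ 0#
      step zero    _    = D₀≈0
      step (suc m) D<m≈0 with Q-monic (suc m) | D⊥Q 0 (suc m) (s≤s z≤n)
      ... | cs , length-cs , Q≡cs1 | D⊥Q₀ = begin
        D (+ suc m)                                   ≡⟨ ≡.cong (λ n → D (+ n)) length-cs ⟨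
        D (+ length cs)                               ≈⟨ *-identityˡ _ ⟨
        1# * D (+ length cs)                          ≈⟨ +-identityʳ _ ⟨
        1# * D (+ length cs) + 0#                     ≈⟨ +-identityˡ _ ⟨
        0# + (1# * D (+ length cs) + 0#)              ≈⟨ +-congʳ lower-terms≈0 ⟨
        apply-from D (+ 0) cs + apply-from D (+ length cs) (1# ∷ [])
                                                      ≈⟨ apply-from-++ D (+ 0) cs (1# ∷ []) ⟨
        apply-from D (+ 0) (cs ++ 1# ∷ [])            ≡⟨ ≡.cong (apply-from D (+ 0)) Q≡cs1 ⟨
        apply D (0 , Q (suc m))                       ≈⟨ D⊥Q₀ ⟩
        0#                                            ∎
        where
        lower-terms≈0 : apply-from D (+ 0) cs ≈ 0#
        lower-terms≈0 = apply-from-vanishing D (+ 0) cs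
          (λ i i<cs → D<m≈0 (≡.subst (i <_) length-cs i<cs))

    vanishes-from : ∀ n i → D (ℤ.- (+ n) ℤ.+ + i) ≈ 0#
    vanishes-from zero    i       = vanishes-on-ℕ i
    vanishes-from (suc n) (suc i) =
      ≡.subst (λ z → D z ≈ 0#) (≡.sym (-[1+m]+[1+n]≡-m+n n i)) (vanishes-from n i)
    vanishes-from (suc n) zero
      with Q (suc (suc n)) | D⊥Q (suc n) (suc (suc n)) ℕₚ.≤-refl | Q-at0≉0 (suc n)
    ... | []     | _     | 0≉0  = ⊥-elim (0≉0 refl)
    ... | q₀ ∷ q | D⊥Qₙ | q₀≉0 = x≉0∧x*y≈0⇒y≈0 q₀≉0 (begin
      q₀ * D -[1+ n ]                                        ≈⟨ +-identityʳ _ ⟨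
      q₀ * D -[1+ n ] + 0#                                   ≈⟨ +-congˡ (apply-from-vanishing D _ q tail≈0) ⟨
      q₀ * D -[1+ n ] + apply-from D (-[1+ n ] ℤ.+ + 1) q    ≈⟨ D⊥Qₙ ⟩
      0#                                                     ∎)
      where
      tail≈0 : ∀ i → i < length q → D (-[1+ n ] ℤ.+ + 1 ℤ.+ + i) ≈ 0#
      tail≈0 i _ = ≡.subst (λ z → D z ≈ 0#)
        (≡.sym (≡.trans (ℤₚ.+-assoc -[1+ n ] (+ 1) (+ i)) (-[1+m]+[1+n]≡-m+n n i)))
        (vanishes-from n i)

    orthogonal⇒apply≈0 : ∀ f → apply D f ≈ 0#
    orthogonal⇒apply≈0 (n , p) = apply-from-vanishing D _ p (λ i _ → D≈0 _)
      where
      D≈0 : ∀ z → D z ≈ 0#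
      D≈0 (+ m)     = vanishes-on-ℕ m
      D≈0 -[1+ n ] = vanishes-from (suc n) 0

  difference : Carrier → Functional → Functional → Functional
  difference β μ ν z = μ z + (- β) * ν (z ℤ.+ -1ℤ)

  apply-difference : ∀ β μ ν f → apply (difference β μ ν) f ≈ apply μ f - β * apply ν (x⁻¹* f)
  apply-difference β μ ν (n , p) = begin
    apply (difference β μ ν) (n , p)                           ≈⟨ apply-from-+ μ _ _ p ⟩
    apply μ (n , p) + apply-from (λ z → (- β) * ν (z ℤ.+ -1ℤ)) (ℤ.- (+ n)) p
                                                               ≈⟨ +-congˡ (apply-from-* (- β) _ _ p) ⟩
    apply μ (n , p) + (- β) * apply (λ z → ν (z ℤ.+ -1ℤ)) (n , p)
                                                               ≡⟨ ≡.cong (λ y → apply μ (n , p) + (- β) * y) (apply-x⁻¹ ν (n , p)) ⟩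
    apply μ (n , p) + (- β) * apply ν (x⁻¹* (n , p))          ≈⟨ +-congˡ (-‿distribˡ-* β _) ⟨
    apply μ (n , p) - β * apply ν (x⁻¹* (n , p))              ∎

  b₀*moment₋₁≈1 : ∀ b a (𝓛 : Functional) → apply 𝓛 (0 , 1# ∷ []) ≈ 1# →
    apply 𝓛 (1 , P b a 1) ≈ 0# → b 0 * 𝓛 -1ℤ ≈ 1#
  b₀*moment₋₁≈1 b a 𝓛 𝓛[1]≈1 𝓛⊥P₁ = sym (trans (sym 𝓛[1]≈1) (x∙y⁻¹≈ε⇒x≈y _ _ (begin
    (1# * 𝓛 (+ 0) + 0#) - b 0 * 𝓛 -1ℤ                     ≈⟨ +-comm _ _ ⟩
    - (b 0 * 𝓛 -1ℤ) + (1# * 𝓛 (+ 0) + 0#)                 ≈⟨ +-congʳ (-‿distribˡ-* (b 0) _) ⟩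
    (- b 0) * 𝓛 -1ℤ + (1# * 𝓛 (+ 0) + 0#)                 ≈⟨ +-congʳ (*-congʳ (trans (+-identityˡ _) (*-identityʳ _))) ⟨
    (0# + (- b 0) * 1#) * 𝓛 -1ℤ + (1# * 𝓛 (+ 0) + 0#)    ≈⟨ 𝓛⊥P₁ ⟩
    0#                                                     ∎)))

proposition4p4 : {c ℓ : Level} (K : Field c ℓ) → let open Field K in let open FieldDefs K in
    (b a : ℕ → Carrier) →
    (∀ n → ¬ (at0 (P b a (suc n)) ≈ 0#)) →
    (∀ n → ¬ (a (suc n) ≈ 0#)) →
    (𝓕 𝓛 : Functional) →
    apply 𝓕 (0 , 1# ∷ []) ≈ 1# →
    (∀ n m → n < m → apply 𝓕 (n , P b a m) ≈ 0#) →
    apply 𝓛 (0 , 1# ∷ []) ≈ 1# →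
    (∀ n m → 0 < n → n ≤ m → apply 𝓛 (n , P b a m) ≈ 0#) →
    (f : Laurent) → apply 𝓕 f ≈ b 0 * apply 𝓛 (x⁻¹* f)
proposition4p4 K b a P₀≉0 _ 𝓕 𝓛 𝓕[1]≈1 𝓕⊥P 𝓛[1]≈1 𝓛⊥P f =
  x∙y⁻¹≈ε⇒x≈y _ _ (trans (sym (apply-difference K (b 0) 𝓕 𝓛 f))
    (orthogonal⇒apply≈0 K (P b a) (P-monic K b a) P₀≉0 D D₀≈0 D⊥P f))
  where
  open Field K
  open FieldDefs K
  open import Algebra.Properties.Group +-group using (x∙y⁻¹≈ε⇒x≈y; x≈y⇒x∙y⁻¹≈ε)
  open import Algebra.Properties.Ring ring using (-‿distribˡ-*)

  D : Functional
  D = difference K (b 0) 𝓕 𝓛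

  D₀≈0 : D (+ 0) ≈ 0#
  D₀≈0 = trans (+-congˡ (sym (-‿distribˡ-* (b 0) _))) (x≈y⇒x∙y⁻¹≈ε (trans 𝓕₀≈1 (sym b₀𝓛₋₁≈1)))
    where
    𝓕₀≈1 : 𝓕 (+ 0) ≈ 1#
    𝓕₀≈1 = trans (sym (trans (+-identityʳ _) (*-identityˡ _))) 𝓕[1]≈1
    b₀𝓛₋₁≈1 : b 0 * 𝓛 -1ℤ ≈ 1#
    b₀𝓛₋₁≈1 = b₀*moment₋₁≈1 K b a 𝓛 𝓛[1]≈1 (𝓛⊥P 1 1 (s≤s z≤n) (s≤s z≤n))

  D⊥P : ∀ n m → n < m → apply D (n , P b a m) ≈ 0#
  D⊥P n m n<m = trans (apply-difference K (b 0) 𝓕 𝓛 (n , P b a m))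
                       (x≈y⇒x∙y⁻¹≈ε (trans (𝓕⊥P n m n<m) (sym b₀𝓛≈0)))
    where
    b₀𝓛≈0 : b 0 * apply 𝓛 (suc n , P b a m) ≈ 0#
    b₀𝓛≈0 = trans (*-congˡ (𝓛⊥P (suc n) m (s≤s z≤n) n<m)) (zeroʳ (b 0))
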